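{- Let $n\geq 4$ be composite, let $G_n=\mathbb{Z}_n\times\mathbb{Z}_n$, let $S=\{(i,0),(0,i),(i,i): 1\leq i\leq n-1\}\subset G_n$, and let $\Gamma(n)=\mathrm{Cay}(G_n;S)$ (vertices $G_n$, $g\sim h$ iff $h-g\in S$). Then $\Gamma(n)$ is not edge-transitive.
   Context: A graph is edge-transitive if its automorphism group acts transitively on its set of (undirected) edges. -}

module Defs where

open import Data.Nat using (ℕ; zero; suc; _+_; _∸_; NonZero)
open import Data.Nat.DivMod using (_mod_)
open import Data.Fin using (Fin; toℕ)
open import Data.Product using (_×_; _,_; Σ; proj₁; proj₂)
open import Data.Sum using (_⊎_)
open import Relation.Binary.PropositionalEquality using (_≡_; _≢_)
open import Relation.Nullary using (¬_)
open import Function.Bundles using (_↔_; Inverse)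

G : ℕ → Set
G n = Fin n × Fin n

subℤ : (n : ℕ) .{{_ : NonZero n}} → Fin n → Fin n → Fin n
subℤ n a b = (toℕ a + (n ∸ toℕ b)) mod n

subG : (n : ℕ) .{{_ : NonZero n}} → G n → G n → G n
subG n (a₁ , a₂) (b₁ , b₂) = subℤ n a₁ b₁ , subℤ n a₂ b₂

InS : (n : ℕ) → G n → Set
InS n (a , b) =
  (toℕ a ≢ 0 × toℕ b ≡ 0) ⊎ ((toℕ a ≡ 0 × toℕ b ≢ 0) ⊎ (toℕ a ≢ 0 × a ≡ b))

Adj : (n : ℕ) .{{_ : NonZero n}} → G n → G n → Set
Adj n g h = InS n (subG n h g)

record Automorphism (n : ℕ) .{{_ : NonZero n}} : Set where
  field
    bij      : G n ↔ G n
  open Inverse bij public using (to)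
  field
    preserves : ∀ g h → Adj n g h → Adj n (to g) (to h)
    reflects  : ∀ g h → Adj n (to g) (to h) → Adj n g h

EdgeTransitive : (n : ℕ) .{{_ : NonZero n}} → Set
EdgeTransitive n =
  ∀ u v x y → Adj n u v → Adj n x y →
  Σ (Automorphism n) λ φ →
    let f = Automorphism.to φ in
    (f u ≡ x × f v ≡ y) ⊎ (f u ≡ y × f v ≡ x)

-- Γ(n) is the Cayley graph on ℤₙ² whose connection set consists of the nonzero points of
-- the three lines through 0 in the directions (1,0), (0,1) and (1,1).  Every edge lies on
-- exactly one of these lines, and off that line its ends have exactly two common
-- neighbours, the apexes.  For n ≥ 4 a collinear triangle always has a common neighbour,
-- whereas the apex triangles on a unit step have none.  Hence, given isolated triangles
-- x y r and r s y with s ≠ x, any isolated triangle s y z with z ≠ r has z = 2y - x, and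
-- such configurations exist along every row.  Automorphisms preserve them, so an
-- automorphism maps the row k·(1,0) to an arithmetic progression whose step has additive
-- order n.  If n = q·d with 1 < d < n, edge transitivity would give an automorphism sending
-- the edge {0, (1,0)} to {0, (d,0)}, whose step ±d has order q < n.

module Submission where

open import Defs
open import Data.Nat using (ℕ; _≥_; NonZero)
open import Data.Nat.Primality using (Composite)
open import Relation.Nullary using (¬_)

open import Data.Empty using (⊥; ⊥-elim)
open import Data.Fin using (Fin; toℕ; fromℕ<)
import Data.Fin.Properties as Fin
open import Data.Integer using (ℤ; +_; _+_; _-_; -_; _*_; ∣_∣; 0ℤ; 1ℤ) renaming (_⊖_ to _⊖ℕ_)
import Data.Integer.Properties as ℤ
open import Data.Integer.DivMod using (_%ℕ_; _/ℕ_; n%ℕd<d; a≡a%ℕn+[a/ℕn]*n)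
open import Data.Integer.Divisibility.Signed using (_∣_; divides; ∣⇒∣ᵤ; ∣m∣n⇒∣m+n; ∣m⇒∣-m)
open import Data.Integer.Tactic.RingSolver using (solve; solve-∀)
open import Data.List using (_∷_; [])
open import Data.Nat as ℕ using (zero; suc; _∸_)
open import Data.Nat.Divisibility as ℕ using (>⇒∤; quotient≢0; quotient-<)
import Data.Nat.Properties as ℕ
open import Data.Nat.Primality using (composite)
open import Data.Product as Product using (Σ; ∃; _×_; _,_; proj₁; proj₂; map₂; swap)
open import Data.Sum as Sum using (_⊎_; inj₁; inj₂; [_,_]′)
open import Function.Base using (_∘_)
open import Function.Bundles using (_⇔_; mk⇔; Equivalence; Inverse; Injection)
open import Function.Properties.Inverse using (↔⇒↣)
open import Relation.Binary.Core using (Rel)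
open import Relation.Binary.PropositionalEquality
open import Relation.Binary.Structures using (IsEquivalence)
open import Relation.Nullary using (contradiction)

record Graph : Set₁ where
  infix 4 _≈_ _~_
  field
    Vertex          : Set
    _≈_             : Rel Vertex _
    ≈-isEquivalence : IsEquivalence _≈_
    _~_             : Rel Vertex _
    ~-respˡ         : ∀ {x x′ y} → x ≈ x′ → x ~ y → x′ ~ y
    ~-respʳ         : ∀ {x y y′} → y ≈ y′ → x ~ y → x ~ y′

  open IsEquivalence ≈-isEquivalence public
    renaming (refl to ≈-refl; sym to ≈-sym; trans to ≈-trans)

  CommonNeighbour : Vertex → Vertex → Vertex → Set
  CommonNeighbour x y z = ∃ λ w → x ~ w × y ~ w × z ~ w

  Isolated : Vertex → Vertex → Vertex → Set
  Isolated x y z = x ~ y × y ~ z × x ~ z × ¬ CommonNeighbour x y z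

  Continues : Vertex → Vertex → Vertex → Set
  Continues x y z = ∃ λ r → ∃ λ s →
    Isolated x y r × Isolated r s y × ¬ s ≈ x × Isolated s y z × ¬ z ≈ r

record Isomorphism (Γ Δ : Graph) : Set where
  private
    module Γ = Graph Γ
    module Δ = Graph Δ
  field
    to         : Graph.Vertex Γ → Graph.Vertex Δ
    to-cong    : ∀ {x y} → x Γ.≈ y → to x Δ.≈ to y
    injective  : ∀ {x y} → to x Δ.≈ to y → x Γ.≈ y
    surjective : ∀ w → Σ (Graph.Vertex Γ) λ v → to v Δ.≈ w
    preserves  : ∀ {x y} → x Γ.~ y → to x Δ.~ to y
    reflects   : ∀ {x y} → to x Δ.~ to y → x Γ.~ y

  from : Graph.Vertex Δ → Graph.Vertex Γ
  from w = proj₁ (surjective w)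

  to-from : ∀ w → to (from w) Δ.≈ w
  to-from w = proj₂ (surjective w)

  preserves-isolated : ∀ {x y z} → Γ.Isolated x y z → Δ.Isolated (to x) (to y) (to z)
  preserves-isolated (xy , yz , xz , ¬common) =
    preserves xy , preserves yz , preserves xz ,
    λ (w , xw , yw , zw) → ¬common (from w , pull xw , pull yw , pull zw)
    where
    pull : ∀ {v w} → to v Δ.~ w → v Γ.~ from w
    pull vw = reflects (Δ.~-respʳ (Δ.≈-sym (to-from _)) vw)

  preserves-continues : ∀ {x y z} → Γ.Continues x y z → Δ.Continues (to x) (to y) (to z)
  preserves-continues (r , s , xyr , rsy , s≉x , syz , z≉r) =
    to r , to s , preserves-isolated xyr , preserves-isolated rsy , (λ e → s≉x (injective e)) ,
    preserves-isolated syz , (λ e → z≉r (injective e))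

inverse : ∀ {Γ Δ} → Isomorphism Γ Δ → Isomorphism Δ Γ
inverse {Γ} {Δ} f = record
  { to         = from
  ; to-cong    = λ w≈w′ → injective (Δ.≈-trans (to-from _) (Δ.≈-trans w≈w′ (Δ.≈-sym (to-from _))))
  ; injective  = λ e → Δ.≈-trans (Δ.≈-sym (to-from _)) (Δ.≈-trans (to-cong e) (to-from _))
  ; surjective = λ v → to v , injective (to-from (to v))
  ; preserves  = λ vw → reflects (Δ.~-respˡ (Δ.≈-sym (to-from _)) (Δ.~-respʳ (Δ.≈-sym (to-from _)) vw))
  ; reflects   = λ e → Δ.~-respˡ (to-from _) (Δ.~-respʳ (to-from _) (preserves e))
  }
  where
  open Isomorphism f
  module Δ = Graph Δ

_∘ᴵ_ : ∀ {Γ Δ Θ} → Isomorphism Δ Θ → Isomorphism Γ Δ → Isomorphism Γ Θ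
_∘ᴵ_ {Γ} {Δ} {Θ} g f = record
  { to         = λ v → G.to (F.to v)
  ; to-cong    = λ e → G.to-cong (F.to-cong e)
  ; injective  = λ e → F.injective (G.injective e)
  ; surjective = λ w → F.from (G.from w) , Θ.≈-trans (G.to-cong (F.to-from _)) (G.to-from w)
  ; preserves  = λ e → G.preserves (F.preserves e)
  ; reflects   = λ e → F.reflects (G.reflects e)
  }
  where
  module F = Isomorphism f
  module G = Isomorphism g
  module Θ = Graph Θ

module Modulo (n : ℕ) where

  infix 4 _≈_ _≉_
  -- A record, so that x and y can be recovered from the type x ≈ y by unification.
  record _≈_ (x y : ℤ) : Set where
    constructor ≈-intro
    field n∣x-y : + n ∣ x - y

  _≉_ : ℤ → ℤ → Set
  x ≉ y = ¬ x ≈ y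

  -- Congruences are combined by writing the new difference as a sum of known ones;
  -- the integer ring solver checks that identity.
  ≈-by₁ : ∀ {x x₁ y y₁} → x₁ ≈ y₁ → x - y ≡ x₁ - y₁ → x ≈ y
  ≈-by₁ (≈-intro h) eq = ≈-intro (subst (+ n ∣_) (sym eq) h)

  ≈-by₂ : ∀ {x x₁ x₂ y y₁ y₂} → x₁ ≈ y₁ → x₂ ≈ y₂ → x - y ≡ (x₁ - y₁) + (x₂ - y₂) → x ≈ y
  ≈-by₂ (≈-intro h₁) (≈-intro h₂) eq = ≈-intro (subst (+ n ∣_) (sym eq) (∣m∣n⇒∣m+n h₁ h₂))

  ≈-by₃ : ∀ {x x₁ x₂ x₃ y y₁ y₂ y₃} → x₁ ≈ y₁ → x₂ ≈ y₂ → x₃ ≈ y₃ →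
          x - y ≡ (x₁ - y₁) + (x₂ - y₂) + (x₃ - y₃) → x ≈ y
  ≈-by₃ (≈-intro h₁) (≈-intro h₂) (≈-intro h₃) eq =
    ≈-intro (subst (+ n ∣_) (sym eq) (∣m∣n⇒∣m+n (∣m∣n⇒∣m+n h₁ h₂) h₃))

  ≈-reflexive : ∀ {x y} → x ≡ y → x ≈ y
  ≈-reflexive {x} refl = ≈-intro (divides 0ℤ (x-x≡0*m x (+ n)))
    where
    x-x≡0*m : ∀ x m → x - x ≡ 0ℤ * m
    x-x≡0*m = solve-∀

  ≈-refl : ∀ {x} → x ≈ x
  ≈-refl = ≈-reflexive refl

  ≈-sym : ∀ {x y} → x ≈ y → y ≈ x
  ≈-sym {x} {y} (≈-intro h) = ≈-intro (subst (+ n ∣_) (-[x-y]≡y-x x y) (∣m⇒∣-m h))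
    where
    -[x-y]≡y-x : ∀ x y → - (x - y) ≡ y - x
    -[x-y]≡y-x = solve-∀

  ≈-trans : ∀ {x y z} → x ≈ y → y ≈ z → x ≈ z
  ≈-trans {x} {y} {z} h₁ h₂ = ≈-by₂ h₁ h₂ (solve (x ∷ y ∷ z ∷ []))

  +-≈-injective : ∀ {i j} → i ℕ.< n → j ℕ.< n → + i ≈ + j → i ≡ j
  +-≈-injective {i} {j} i<n j<n (≈-intro n∣i-j) =
    ℤ.+-injective (ℤ.i-j≡0⇒i≡j _ _ (ℤ.∣i∣≡0⇒i≡0 (∣∧<⇒≡0 (∣⇒∣ᵤ n∣i-j) ∣i-j∣<n)))
    where
    ∣∧<⇒≡0 : ∀ {m} → n ℕ.∣ m → m ℕ.< n → m ≡ 0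
    ∣∧<⇒≡0 {zero}  _   _   = refl
    ∣∧<⇒≡0 {suc m} n∣m m<n = contradiction n∣m (>⇒∤ m<n)
    ∣i-j∣<n : ∣ + i - + j ∣ ℕ.< n
    ∣i-j∣<n = begin-strict
      ∣ + i - + j ∣  ≡⟨ cong ∣_∣ (ℤ.m-n≡m⊖n i j) ⟩
      ∣ i ⊖ℕ j ∣     ≤⟨ ℤ.∣m⊝n∣≤m⊔n i j ⟩
      i ℕ.⊔ j        <⟨ ℕ.⊔-lub i<n j<n ⟩
      n              ∎
      where open ℕ.≤-Reasoning

  +-≉0 : ∀ {j} → 0 ℕ.< j → j ℕ.< n → + j ≉ 0ℤ
  +-≉0 {suc j} 0<j j<n j≈0 with +-≈-injective j<n (ℕ.<-trans 0<j j<n) j≈0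
  ... | ()

  -- The geometry is done in the cover ℤ² of ℤₙ², comparing coordinates modulo n.  A data
  -- type rather than ℤ × ℤ, so that matching on a point binds variables the solver accepts.
  infixr 4 _,_
  data ℤ² : Set where
    _,_ : ℤ → ℤ → ℤ²

  infix 4 _≈²_
  _≈²_ : ℤ² → ℤ² → Set
  (x₁ , x₂) ≈² (y₁ , y₂) = x₁ ≈ y₁ × x₂ ≈ y₂

  infixl 6 _⊕_ _⊖_
  _⊕_ _⊖_ : ℤ² → ℤ² → ℤ²
  (x₁ , x₂) ⊕ (y₁ , y₂) = x₁ + y₁ , x₂ + y₂
  (x₁ , x₂) ⊖ (y₁ , y₂) = x₁ - y₁ , x₂ - y₂

  data Direction : Set where
    horizontal vertical diagonal : Direction

  infix 7 _∙_
  _∙_ : ℤ → Direction → ℤ²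
  t ∙ horizontal = t , 0ℤ
  t ∙ vertical   = 0ℤ , t
  t ∙ diagonal   = t , t

  InSℤ : ℤ² → Set
  InSℤ (a , b) = (a ≉ 0ℤ × b ≈ 0ℤ) ⊎ (a ≈ 0ℤ × b ≉ 0ℤ) ⊎ (a ≉ 0ℤ × a ≈ b)

  infix 4 _~_
  record _~_ (P Q : ℤ²) : Set where
    constructor adjacent
    field offset∈S : InSℤ (Q ⊖ P)

  ≈²-refl : ∀ {P} → P ≈² P
  ≈²-refl {_ , _} = ≈-refl , ≈-refl

  ≈²-sym : ∀ {P Q} → P ≈² Q → Q ≈² P
  ≈²-sym {_ , _} {_ , _} (e₁ , e₂) = ≈-sym e₁ , ≈-sym e₂

  ≈²-trans : ∀ {P Q R} → P ≈² Q → Q ≈² R → P ≈² R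
  ≈²-trans {_ , _} {_ , _} {_ , _} (e₁ , e₂) (f₁ , f₂) = ≈-trans e₁ f₁ , ≈-trans e₂ f₂

  ≉-resp : ∀ {x y z} → x ≈ y → x ≉ z → y ≉ z
  ≉-resp x≈y x≉z y≈z = x≉z (≈-trans x≈y y≈z)

  InSℤ-resp : ∀ {δ ε} → δ ≈² ε → InSℤ δ → InSℤ ε
  InSℤ-resp {_ , _} {_ , _} (a≈ , b≈) (inj₁ (a≉0 , b≈0)) =
    inj₁ (≉-resp a≈ a≉0 , ≈-trans (≈-sym b≈) b≈0)
  InSℤ-resp {_ , _} {_ , _} (a≈ , b≈) (inj₂ (inj₁ (a≈0 , b≉0))) =
    inj₂ (inj₁ (≈-trans (≈-sym a≈) a≈0 , ≉-resp b≈ b≉0))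
  InSℤ-resp {_ , _} {_ , _} (a≈ , b≈) (inj₂ (inj₂ (a≉0 , a≈b))) =
    inj₂ (inj₂ (≉-resp a≈ a≉0 , ≈-trans (≈-sym a≈) (≈-trans a≈b b≈)))

  InSℤ-swap : ∀ {a b} → InSℤ (a , b) → InSℤ (b , a)
  InSℤ-swap (inj₁ (a≉0 , b≈0))         = inj₂ (inj₁ (b≈0 , a≉0))
  InSℤ-swap (inj₂ (inj₁ (a≈0 , b≉0)))  = inj₁ (b≉0 , a≈0)
  InSℤ-swap (inj₂ (inj₂ (a≉0 , a≈b)))  = inj₂ (inj₂ (≉-resp a≈b a≉0 , ≈-sym a≈b))

  neg-cong : ∀ {a b} → a ≈ b → - a ≈ - b
  neg-cong {a} {b} e = ≈-by₁ (≈-sym e) (solve (a ∷ b ∷ []))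

  neg-≉0 : ∀ {a} → a ≉ 0ℤ → - a ≉ 0ℤ
  neg-≉0 {a} a≉0 -a≈0 = a≉0 (≈-by₁ (≈-sym -a≈0) (solve (a ∷ [])))

  InSℤ-neg : ∀ {a b} → InSℤ (a , b) → InSℤ (- a , - b)
  InSℤ-neg (inj₁ (a≉0 , b≈0))        = inj₁ (neg-≉0 a≉0 , neg-cong b≈0)
  InSℤ-neg (inj₂ (inj₁ (a≈0 , b≉0))) = inj₂ (inj₁ (neg-cong a≈0 , neg-≉0 b≉0))
  InSℤ-neg (inj₂ (inj₂ (a≉0 , a≈b))) = inj₂ (inj₂ (neg-≉0 a≉0 , neg-cong a≈b))

  InSℤ-∙ : ∀ {t} u → t ≉ 0ℤ → InSℤ (t ∙ u)
  InSℤ-∙ horizontal t≉0 = inj₁ (t≉0 , ≈-refl)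
  InSℤ-∙ vertical   t≉0 = inj₂ (inj₁ (≈-refl , t≉0))
  InSℤ-∙ diagonal   t≉0 = inj₂ (inj₂ (t≉0 , ≈-refl))

  ~-sym : ∀ {P Q} → P ~ Q → Q ~ P
  ~-sym {p₁ , p₂} {q₁ , q₂} (adjacent Q-P∈S) =
    adjacent (InSℤ-resp (≈-reflexive (-[q-p]≡p-q q₁ p₁) , ≈-reflexive (-[q-p]≡p-q q₂ p₂))
                        (InSℤ-neg Q-P∈S))
    where
    -[q-p]≡p-q : ∀ q p → - (q - p) ≡ p - q
    -[q-p]≡p-q = solve-∀

  ~-respˡ : ∀ {P P′ Q} → P ≈² P′ → P ~ Q → P′ ~ Q
  ~-respˡ {p₁ , p₂} {p₁′ , p₂′} {q₁ , q₂} (e₁ , e₂) (adjacent Q-P∈S) =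
    adjacent (InSℤ-resp (≈-by₁ (≈-sym e₁) (solve (q₁ ∷ p₁ ∷ p₁′ ∷ [])) ,
                         ≈-by₁ (≈-sym e₂) (solve (q₂ ∷ p₂ ∷ p₂′ ∷ []))) Q-P∈S)

  ~-respʳ : ∀ {P Q Q′} → Q ≈² Q′ → P ~ Q → P ~ Q′
  ~-respʳ {p₁ , p₂} {q₁ , q₂} {q₁′ , q₂′} (e₁ , e₂) (adjacent Q-P∈S) =
    adjacent (InSℤ-resp (≈-by₁ e₁ (solve (q₁ ∷ q₁′ ∷ p₁ ∷ [])) ,
                         ≈-by₁ e₂ (solve (q₂ ∷ q₂′ ∷ p₂ ∷ []))) Q-P∈S)

  ≈⊕⇒⊖≈ : ∀ {P Q δ} → Q ≈² P ⊕ δ → Q ⊖ P ≈² δ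
  ≈⊕⇒⊖≈ {p₁ , p₂} {q₁ , q₂} {d₁ , d₂} (e₁ , e₂) =
    ≈-by₁ e₁ (solve (q₁ ∷ p₁ ∷ d₁ ∷ [])) , ≈-by₁ e₂ (solve (q₂ ∷ p₂ ∷ d₂ ∷ []))

  ⊖-shift : ∀ {P Q W e} → Q ≈² P ⊕ e → W ⊖ Q ≈² (W ⊖ P) ⊖ e
  ⊖-shift {p₁ , p₂} {q₁ , q₂} {w₁ , w₂} {e₁ , e₂} (q₁≈ , q₂≈) =
    ≈-by₁ (≈-sym q₁≈) (solve (p₁ ∷ q₁ ∷ w₁ ∷ e₁ ∷ [])) , ≈-by₁ (≈-sym q₂≈) (solve (p₂ ∷ q₂ ∷ w₂ ∷ e₂ ∷ []))

  ⊖≈⇒≈⊕ : ∀ {P Q δ} → Q ⊖ P ≈² δ → Q ≈² P ⊕ δ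
  ⊖≈⇒≈⊕ {p₁ , p₂} {q₁ , q₂} {d₁ , d₂} (e₁ , e₂) =
    ≈-by₁ e₁ (solve (q₁ ∷ p₁ ∷ d₁ ∷ [])) , ≈-by₁ e₂ (solve (q₂ ∷ p₂ ∷ d₂ ∷ []))

  ~-by-offset : ∀ {P Q δ} → InSℤ δ → Q ≈² P ⊕ δ → P ~ Q
  ~-by-offset {P} {Q} {δ} δ∈S Q≈P⊕δ = adjacent (InSℤ-resp (≈²-sym {Q ⊖ P} {δ} (≈⊕⇒⊖≈ {P} {Q} {δ} Q≈P⊕δ)) δ∈S)

  cover : Graph
  cover = record
    { Vertex          = ℤ²
    ; _≈_             = _≈²_
    ; ≈-isEquivalence = record { refl = ≈²-refl ; sym = ≈²-sym ; trans = ≈²-trans }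
    ; _~_             = _~_
    ; ~-respˡ         = ~-respˡ
    ; ~-respʳ         = ~-respʳ
    }

  open Graph cover public using (CommonNeighbour; Isolated; Continues)

  common-offset-horizontal : ∀ {a b t} → t ≉ 0ℤ → InSℤ (a , b) → InSℤ (a - t , b - 0ℤ) →
    (∃ λ s → a ≈ s × b ≈ 0ℤ) ⊎ (a ≈ 0ℤ × b ≈ - t) ⊎ (a ≈ t × b ≈ t)
  common-offset-horizontal _ (inj₁ (_ , b≈0)) _ = inj₁ (_ , ≈-refl , b≈0)
  common-offset-horizontal {a} {b} {t} t≉0 (inj₂ (inj₁ (a≈0 , b≉0))) (inj₁ (_ , b-0≈0)) =
    ⊥-elim (b≉0 (≈-by₁ b-0≈0 (solve (b ∷ []))))
  common-offset-horizontal {a} {b} {t} t≉0 (inj₂ (inj₁ (a≈0 , _))) (inj₂ (inj₁ (a-t≈0 , _))) =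
    ⊥-elim (t≉0 (≈-by₂ a≈0 (≈-sym a-t≈0) (solve (a ∷ t ∷ []))))
  common-offset-horizontal {a} {b} {t} t≉0 (inj₂ (inj₁ (a≈0 , _))) (inj₂ (inj₂ (_ , a-t≈b-0))) =
    inj₂ (inj₁ (a≈0 , ≈-by₂ a≈0 (≈-sym a-t≈b-0) (solve (a ∷ b ∷ t ∷ []))))
  common-offset-horizontal {a} {b} {t} t≉0 (inj₂ (inj₂ (a≉0 , a≈b))) (inj₁ (_ , b-0≈0)) =
    ⊥-elim (a≉0 (≈-by₂ a≈b b-0≈0 (solve (a ∷ b ∷ []))))
  common-offset-horizontal {a} {b} {t} t≉0 (inj₂ (inj₂ (_ , a≈b))) (inj₂ (inj₁ (a-t≈0 , _))) =
    inj₂ (inj₂ (≈-by₁ a-t≈0 (solve (a ∷ t ∷ [])) , ≈-by₂ (≈-sym a≈b) a-t≈0 (solve (a ∷ b ∷ t ∷ []))))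
  common-offset-horizontal {a} {b} {t} t≉0 (inj₂ (inj₂ (_ , a≈b))) (inj₂ (inj₂ (_ , a-t≈b-0))) =
    ⊥-elim (t≉0 (≈-by₂ a≈b (≈-sym a-t≈b-0) (solve (a ∷ b ∷ t ∷ []))))

  common-offset-vertical : ∀ {a b t} → t ≉ 0ℤ → InSℤ (a , b) → InSℤ (a - 0ℤ , b - t) →
    (∃ λ s → a ≈ 0ℤ × b ≈ s) ⊎ (a ≈ - t × b ≈ 0ℤ) ⊎ (a ≈ t × b ≈ t)
  common-offset-vertical t≉0 ab∈S ab-tv∈S =
    Sum.map (map₂ swap) (Sum.map swap swap)
            (common-offset-horizontal t≉0 (InSℤ-swap ab∈S) (InSℤ-swap ab-tv∈S))

  common-offset-diagonal : ∀ {a b t} → t ≉ 0ℤ → InSℤ (a , b) → InSℤ (a - t , b - t) →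
    (∃ λ s → a ≈ s × b ≈ s) ⊎ (a ≈ t × b ≈ 0ℤ) ⊎ (a ≈ 0ℤ × b ≈ t)
  common-offset-diagonal _ (inj₂ (inj₂ (_ , a≈b))) _ = inj₁ (_ , ≈-refl , ≈-sym a≈b)
  common-offset-diagonal {a} {b} {t} _ _ (inj₂ (inj₂ (_ , a-t≈b-t))) =
    inj₁ (_ , ≈-refl , ≈-by₁ (≈-sym a-t≈b-t) (solve (a ∷ b ∷ t ∷ [])))
  common-offset-diagonal {a} {b} {t} t≉0 (inj₁ (_ , b≈0)) (inj₁ (_ , b-t≈0)) =
    ⊥-elim (t≉0 (≈-by₂ b≈0 (≈-sym b-t≈0) (solve (b ∷ t ∷ []))))
  common-offset-diagonal {a} {b} {t} _ (inj₁ (_ , b≈0)) (inj₂ (inj₁ (a-t≈0 , _))) =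
    inj₂ (inj₁ (≈-by₁ a-t≈0 (solve (a ∷ t ∷ [])) , b≈0))
  common-offset-diagonal {a} {b} {t} _ (inj₂ (inj₁ (a≈0 , _))) (inj₁ (_ , b-t≈0)) =
    inj₂ (inj₂ (a≈0 , ≈-by₁ b-t≈0 (solve (b ∷ t ∷ []))))
  common-offset-diagonal {a} {b} {t} t≉0 (inj₂ (inj₁ (a≈0 , _))) (inj₂ (inj₁ (a-t≈0 , _))) =
    ⊥-elim (t≉0 (≈-by₂ a≈0 (≈-sym a-t≈0) (solve (a ∷ t ∷ []))))

  common-neighbour-horizontal : ∀ {P Q W t} → t ≉ 0ℤ → Q ≈² P ⊕ t ∙ horizontal → P ~ W → Q ~ W →
    (∃ λ s → W ≈² P ⊕ s ∙ horizontal) ⊎ W ≈² P ⊕ (- t) ∙ vertical ⊎ W ≈² P ⊕ t ∙ diagonal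
  common-neighbour-horizontal {P@(_ , _)} {Q} {W@(_ , _)} {t} t≉0 Q≈ (adjacent W-P∈S) (adjacent W-Q∈S) =
    Sum.map (λ (s , e) → s , ⊖≈⇒≈⊕ {P} {W} {s ∙ horizontal} e)
            (Sum.map (⊖≈⇒≈⊕ {P} {W} {(- t) ∙ vertical}) (⊖≈⇒≈⊕ {P} {W} {t ∙ diagonal}))
            (common-offset-horizontal t≉0 W-P∈S (InSℤ-resp (⊖-shift {P} {Q} {W} Q≈) W-Q∈S))

  common-neighbour-vertical : ∀ {P Q W t} → t ≉ 0ℤ → Q ≈² P ⊕ t ∙ vertical → P ~ W → Q ~ W →
    (∃ λ s → W ≈² P ⊕ s ∙ vertical) ⊎ W ≈² P ⊕ (- t) ∙ horizontal ⊎ W ≈² P ⊕ t ∙ diagonal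
  common-neighbour-vertical {P@(_ , _)} {Q} {W@(_ , _)} {t} t≉0 Q≈ (adjacent W-P∈S) (adjacent W-Q∈S) =
    Sum.map (λ (s , e) → s , ⊖≈⇒≈⊕ {P} {W} {s ∙ vertical} e)
            (Sum.map (⊖≈⇒≈⊕ {P} {W} {(- t) ∙ horizontal}) (⊖≈⇒≈⊕ {P} {W} {t ∙ diagonal}))
            (common-offset-vertical t≉0 W-P∈S (InSℤ-resp (⊖-shift {P} {Q} {W} Q≈) W-Q∈S))

  common-neighbour-diagonal : ∀ {P Q W t} → t ≉ 0ℤ → Q ≈² P ⊕ t ∙ diagonal → P ~ W → Q ~ W →
    (∃ λ s → W ≈² P ⊕ s ∙ diagonal) ⊎ W ≈² P ⊕ t ∙ horizontal ⊎ W ≈² P ⊕ t ∙ vertical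
  common-neighbour-diagonal {P@(_ , _)} {Q} {W@(_ , _)} {t} t≉0 Q≈ (adjacent W-P∈S) (adjacent W-Q∈S) =
    Sum.map (λ (s , e) → s , ⊖≈⇒≈⊕ {P} {W} {s ∙ diagonal} e)
            (Sum.map (⊖≈⇒≈⊕ {P} {W} {t ∙ horizontal}) (⊖≈⇒≈⊕ {P} {W} {t ∙ vertical}))
            (common-offset-diagonal t≉0 W-P∈S (InSℤ-resp (⊖-shift {P} {Q} {W} Q≈) W-Q∈S))

  -- Double-negated, so that ≈ need not be decided: each rejected candidate j supplies
  -- j ≈ b or j ≈ c.
  small-residue-avoiding : 4 ℕ.≤ n → ∀ b c → (∀ j → j ≉ 0ℤ → j ≉ b → j ≉ c → ⊥) → ⊥
  small-residue-avoiding 3<n b c none = none (+ 1) (clash 1<n 0<n (λ ()) ≈-refl) 1≉b 1≉c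
    where
    2<n = ℕ.<⇒≤ 3<n
    1<n = ℕ.<⇒≤ 2<n
    0<n = ℕ.<⇒≤ 1<n
    clash : ∀ {i j x} → i ℕ.< n → j ℕ.< n → i ≢ j → + j ≈ x → + i ≉ x
    clash i<n j<n i≢j j≈x i≈x = i≢j (+-≈-injective i<n j<n (≈-trans i≈x (≈-sym j≈x)))
    1≉b : + 1 ≉ b
    1≉b 1≈b = none (+ 2) (clash 2<n 0<n (λ ()) ≈-refl) (clash 2<n 1<n (λ ()) 1≈b) λ 2≈c →
      none (+ 3) (clash 3<n 0<n (λ ()) ≈-refl) (clash 3<n 1<n (λ ()) 1≈b) (clash 3<n 2<n (λ ()) 2≈c)
    1≉c : + 1 ≉ c
    1≉c 1≈c = none (+ 2) (clash 2<n 0<n (λ ()) ≈-refl) (λ 2≈b →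
      none (+ 3) (clash 3<n 0<n (λ ()) ≈-refl) (clash 3<n 2<n (λ ()) 2≈b) (clash 3<n 1<n (λ ()) 1≈c))
      (clash 2<n 1<n (λ ()) 1≈c)

  ≉⇒-≉0 : ∀ {j b} → j ≉ b → j - b ≉ 0ℤ
  ≉⇒-≉0 {j} {b} j≉b j-b≈0 = j≉b (≈-by₁ j-b≈0 (solve (j ∷ b ∷ [])))

  ≈+-shift : ∀ x {y b} j → y ≈ x + b → x + j ≈ y + (j - b)
  ≈+-shift x {y} {b} j e = ≈-by₁ (≈-sym e) (solve (x ∷ y ∷ b ∷ j ∷ []))

  ≈+0-shift : ∀ x {y} → y ≈ x + 0ℤ → x + 0ℤ ≈ y + 0ℤ
  ≈+0-shift x {y} e = ≈-by₁ (≈-sym e) (solve (x ∷ y ∷ []))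

  along : ∀ u X {Y b} j → Y ≈² X ⊕ b ∙ u → X ⊕ j ∙ u ≈² Y ⊕ (j - b) ∙ u
  along horizontal (x₁ , x₂) {_ , _} j (e₁ , e₂) = ≈+-shift x₁ j e₁ , ≈+0-shift x₂ e₂
  along vertical   (x₁ , x₂) {_ , _} j (e₁ , e₂) = ≈+0-shift x₁ e₁ , ≈+-shift x₂ j e₂
  along diagonal   (x₁ , x₂) {_ , _} j (e₁ , e₂) = ≈+-shift x₁ j e₁ , ≈+-shift x₂ j e₂

  collinear-not-isolated : 4 ℕ.≤ n → ∀ u {X Y Z b c} → Y ≈² X ⊕ b ∙ u → Z ≈² X ⊕ c ∙ u → ¬ Isolated X Y Z
  collinear-not-isolated 4≤n u {X} {b = b} {c} Y≈ Z≈ (_ , _ , _ , ¬common) =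
    small-residue-avoiding 4≤n b c λ j j≉0 j≉b j≉c → ¬common (X ⊕ j ∙ u ,
      ~-by-offset (InSℤ-∙ u j≉0) ≈²-refl ,
      ~-by-offset (InSℤ-∙ u (≉⇒-≉0 j≉b)) (along u X j Y≈) ,
      ~-by-offset (InSℤ-∙ u (≉⇒-≉0 j≉c)) (along u X j Z≈))

  InSℤ⇒≉0 : ∀ {a b} → InSℤ (a , b) → a ≈ 0ℤ → b ≉ 0ℤ
  InSℤ⇒≉0 (inj₁ (a≉0 , _))        a≈0 = ⊥-elim (a≉0 a≈0)
  InSℤ⇒≉0 (inj₂ (inj₁ (_ , b≉0))) _   = b≉0
  InSℤ⇒≉0 (inj₂ (inj₂ (a≉0 , _))) a≈0 = ⊥-elim (a≉0 a≈0)

  -- The two apexes of a horizontal edge of length t differ by (t, 2t).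
  no-common-offset-below : ∀ {a b t} → t ≉ 0ℤ → t + t ≉ 0ℤ →
    InSℤ (a , b) → InSℤ (a - t , b - 0ℤ) → ¬ InSℤ (a - 0ℤ , b - - t)
  no-common-offset-below {a} {b} {t} t≉0 2t≉0 W-A∈S W-B∈S W-C∈S
    with common-offset-horizontal t≉0 W-A∈S W-B∈S | W-C∈S
  ... | inj₁ (_ , _ , b≈0) | inj₁ (_ , b+t≈0) = t≉0 (≈-by₂ b+t≈0 (≈-sym b≈0) (solve (b ∷ t ∷ [])))
  ... | inj₁ (_ , _ , b≈0) | inj₂ (inj₁ (a-0≈0 , _)) = InSℤ⇒≉0 W-A∈S (≈-by₁ a-0≈0 (solve (a ∷ []))) b≈0
  ... | inj₁ (_ , _ , b≈0) | inj₂ (inj₂ (_ , a-0≈b+t)) =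
    InSℤ⇒≉0 W-B∈S (≈-by₂ a-0≈b+t b≈0 (solve (a ∷ b ∷ t ∷ []))) (≈-by₁ b≈0 (solve (b ∷ [])))
  ... | inj₂ (inj₁ (a≈0 , b≈-t)) | _ =
    InSℤ⇒≉0 W-C∈S (≈-by₁ a≈0 (solve (a ∷ []))) (≈-by₁ b≈-t (solve (b ∷ t ∷ [])))
  ... | inj₂ (inj₂ (_ , b≈t)) | inj₁ (_ , b+t≈0) = 2t≉0 (≈-by₂ b+t≈0 (≈-sym b≈t) (solve (b ∷ t ∷ [])))
  ... | inj₂ (inj₂ (a≈t , _)) | inj₂ (inj₁ (a-0≈0 , _)) = t≉0 (≈-by₂ a-0≈0 (≈-sym a≈t) (solve (a ∷ t ∷ [])))
  ... | inj₂ (inj₂ (a≈t , b≈t)) | inj₂ (inj₂ (_ , a-0≈b+t)) =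
    t≉0 (≈-by₃ (≈-sym a-0≈b+t) a≈t (≈-sym b≈t) (solve (a ∷ b ∷ t ∷ [])))

  no-common-offset-above : ∀ {a b t} → t ≉ 0ℤ → t + t ≉ 0ℤ →
    InSℤ (a , b) → InSℤ (a - t , b - 0ℤ) → ¬ InSℤ (a - t , b - t)
  no-common-offset-above {a} {b} {t} t≉0 2t≉0 W-A∈S W-B∈S W-C∈S
    with common-offset-horizontal t≉0 W-A∈S W-B∈S | W-C∈S
  ... | inj₁ (_ , _ , b≈0) | inj₁ (_ , b-t≈0) = t≉0 (≈-by₂ b≈0 (≈-sym b-t≈0) (solve (b ∷ t ∷ [])))
  ... | inj₁ (_ , _ , b≈0) | inj₂ (inj₁ (a-t≈0 , _)) = InSℤ⇒≉0 W-B∈S a-t≈0 (≈-by₁ b≈0 (solve (b ∷ [])))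
  ... | inj₁ (_ , _ , b≈0) | inj₂ (inj₂ (_ , a-t≈b-t)) =
    InSℤ⇒≉0 W-A∈S (≈-by₂ a-t≈b-t b≈0 (solve (a ∷ b ∷ t ∷ []))) b≈0
  ... | inj₂ (inj₁ (_ , b≈-t)) | inj₁ (_ , b-t≈0) = 2t≉0 (≈-by₂ (≈-sym b-t≈0) b≈-t (solve (b ∷ t ∷ [])))
  ... | inj₂ (inj₁ (a≈0 , _)) | inj₂ (inj₁ (a-t≈0 , _)) = t≉0 (≈-by₂ a≈0 (≈-sym a-t≈0) (solve (a ∷ t ∷ [])))
  ... | inj₂ (inj₁ (a≈0 , b≈-t)) | inj₂ (inj₂ (_ , a-t≈b-t)) =
    t≉0 (≈-by₃ a-t≈b-t (≈-sym a≈0) b≈-t (solve (a ∷ b ∷ t ∷ [])))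
  ... | inj₂ (inj₂ (a≈t , b≈t)) | _ =
    InSℤ⇒≉0 W-C∈S (≈-by₁ a≈t (solve (a ∷ t ∷ []))) (≈-by₁ b≈t (solve (b ∷ t ∷ [])))

  no-common-neighbour-below : ∀ {A B C t} → t ≉ 0ℤ → t + t ≉ 0ℤ →
    B ≈² A ⊕ t ∙ horizontal → C ≈² A ⊕ (- t) ∙ vertical → ¬ CommonNeighbour A B C
  no-common-neighbour-below {A@(_ , _)} {B} {C} t≉0 2t≉0 B≈ C≈
                            (W@(_ , _) , adjacent W-A∈S , adjacent W-B∈S , adjacent W-C∈S) =
    no-common-offset-below t≉0 2t≉0 W-A∈S (InSℤ-resp (⊖-shift {A} {B} {W} B≈) W-B∈S)
                                        (InSℤ-resp (⊖-shift {A} {C} {W} C≈) W-C∈S)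

  no-common-neighbour-above : ∀ {A B C t} → t ≉ 0ℤ → t + t ≉ 0ℤ →
    B ≈² A ⊕ t ∙ horizontal → C ≈² A ⊕ t ∙ diagonal → ¬ CommonNeighbour A B C
  no-common-neighbour-above {A@(_ , _)} {B} {C} t≉0 2t≉0 B≈ C≈
                            (W@(_ , _) , adjacent W-A∈S , adjacent W-B∈S , adjacent W-C∈S) =
    no-common-offset-above t≉0 2t≉0 W-A∈S (InSℤ-resp (⊖-shift {A} {B} {W} B≈) W-B∈S)
                                        (InSℤ-resp (⊖-shift {A} {C} {W} C≈) W-C∈S)

  continues-source : ∀ {X Y Z t} → t ≉ 0ℤ → t + t ≉ 0ℤ →
    Y ≈² X ⊕ t ∙ horizontal → Z ≈² Y ⊕ t ∙ horizontal → Continues X Y Z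
  continues-source {X@(x₁ , x₂)} {Y@(y₁ , y₂)} {Z@(z₁ , z₂)} {t} t≉0 2t≉0 Y≈@(y₁≈ , y₂≈) Z≈@(z₁≈ , z₂≈) =
    R , S ,
    (X~Y , Y~R , X~R , no-common-neighbour-below t≉0 2t≉0 Y≈ R≈) ,
    (R~S , S~Y , R~Y , no-common-neighbour-above t≉0 2t≉0 S≈R⊕th Y≈R⊕td) ,
    (λ (s₁≈x₁ , _) → t≉0 (≈-by₂ (≈-sym y₁≈) s₁≈x₁ (solve (y₁ ∷ x₁ ∷ t ∷ [])))) ,
    (S~Y , Y~Z , S~Z ,
      λ (W , S~W , Y~W , Z~W) → no-common-neighbour-below t≉0 2t≉0 Z≈ S≈ (W , Y~W , Z~W , S~W)) ,
    (λ (_ , z₂≈r₂) → t≉0 (≈-by₃ z₂≈r₂ (≈-sym z₂≈) (≈-sym y₂≈) (solve (z₂ ∷ y₂ ∷ x₂ ∷ t ∷ []))))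
    where
    -t≉0 = neg-≉0 t≉0
    R = X ⊕ (- t) ∙ vertical
    S = Y ⊕ (- t) ∙ vertical
    R≈ : R ≈² X ⊕ (- t) ∙ vertical
    R≈ = ≈²-refl
    S≈ : S ≈² Y ⊕ (- t) ∙ vertical
    S≈ = ≈²-refl
    S≈R⊕th : S ≈² R ⊕ t ∙ horizontal
    S≈R⊕th = ≈-by₁ y₁≈ (solve (y₁ ∷ x₁ ∷ t ∷ [])) , ≈-by₁ y₂≈ (solve (y₂ ∷ x₂ ∷ t ∷ []))
    Y≈R⊕td : Y ≈² R ⊕ t ∙ diagonal
    Y≈R⊕td = ≈-by₁ y₁≈ (solve (y₁ ∷ x₁ ∷ t ∷ [])) , ≈-by₁ y₂≈ (solve (y₂ ∷ x₂ ∷ t ∷ []))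
    X~Y = ~-by-offset (InSℤ-∙ horizontal t≉0) Y≈
    X~R = ~-by-offset (InSℤ-∙ vertical -t≉0) R≈
    Y~R = ~-sym (~-by-offset {R} {Y} (InSℤ-∙ diagonal t≉0) Y≈R⊕td)
    R~S = ~-by-offset (InSℤ-∙ horizontal t≉0) S≈R⊕th
    R~Y = ~-by-offset (InSℤ-∙ diagonal t≉0) Y≈R⊕td
    S~Y = ~-sym (~-by-offset (InSℤ-∙ vertical -t≉0) S≈)
    Y~Z = ~-by-offset (InSℤ-∙ horizontal t≉0) Z≈
    S~Z = ~-by-offset {S} {Z} (InSℤ-∙ diagonal t≉0)
            (≈-by₁ z₁≈ (solve (z₁ ∷ y₁ ∷ t ∷ [])) , ≈-by₁ z₂≈ (solve (z₂ ∷ y₂ ∷ t ∷ [])))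

  horizontal-step≉0 : ∀ {P Q t} → P ~ Q → Q ≈² P ⊕ t ∙ horizontal → t ≉ 0ℤ
  horizontal-step≉0 {P} {Q} {t} (adjacent Q-P∈S) Q≈
    with InSℤ-resp (≈⊕⇒⊖≈ {P} {Q} {t ∙ horizontal} Q≈) Q-P∈S
  ... | inj₁ (t≉0 , _)         = t≉0
  ... | inj₂ (inj₁ (_ , 0≉0))  = ⊥-elim (0≉0 ≈-refl)
  ... | inj₂ (inj₂ (t≉0 , _))  = t≉0

  module _ (4≤n : 4 ℕ.≤ n) where

    continues-below : ∀ {X Y Z R S a} → a ≉ 0ℤ →
      Y ≈² X ⊕ a ∙ horizontal → R ≈² X ⊕ (- a) ∙ vertical →
      Isolated R S Y → ¬ S ≈² X → Isolated S Y Z → ¬ Z ≈² R → Z ≈² Y ⊕ a ∙ horizontal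
    continues-below {X@(x₁ , x₂)} {Y@(y₁ , y₂)} {Z@(z₁ , z₂)} {R@(r₁ , r₂)} {S@(s₁ , s₂)} {a}
                    a≉0 (y₁≈ , y₂≈) (r₁≈ , r₂≈) RSY@(R~S , S~Y , _) S≉X SYZ@(_ , Y~Z , S~Z , _) Z≉R =
      [ (λ (_ , S≈) → ⊥-elim (collinear-not-isolated 4≤n diagonal S≈ Y≈R⊕ad RSY))
      , [ S-right , (λ S≈R⊕av → ⊥-elim (S≉X (S≈X S≈R⊕av))) ]′ ]′
      (common-neighbour-diagonal a≉0 Y≈R⊕ad R~S (~-sym S~Y))
      where
      Y≈R⊕ad : Y ≈² R ⊕ a ∙ diagonal
      Y≈R⊕ad = ≈-by₂ y₁≈ (≈-sym r₁≈) (solve (y₁ ∷ r₁ ∷ x₁ ∷ a ∷ [])) ,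
               ≈-by₂ y₂≈ (≈-sym r₂≈) (solve (y₂ ∷ r₂ ∷ x₂ ∷ a ∷ []))

      S≈X : S ≈² R ⊕ a ∙ vertical → S ≈² X
      S≈X (s₁≈ , s₂≈) = ≈-by₂ s₁≈ r₁≈ (solve (s₁ ∷ r₁ ∷ x₁ ∷ [])) ,
                        ≈-by₂ s₂≈ r₂≈ (solve (s₂ ∷ r₂ ∷ x₂ ∷ a ∷ []))

      S-right : S ≈² R ⊕ a ∙ horizontal → Z ≈² Y ⊕ a ∙ horizontal
      S-right (s₁≈ , s₂≈) =
        [ (λ (_ , Z≈) → ⊥-elim (collinear-not-isolated 4≤n vertical Y≈S⊕av Z≈ SYZ))
        , [ (λ Z≈S⊕-ah → ⊥-elim (Z≉R (Z≈R Z≈S⊕-ah))) , Z≈Y⊕ah ]′ ]′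
        (common-neighbour-vertical a≉0 Y≈S⊕av S~Z Y~Z)
        where
        Y≈S⊕av : Y ≈² S ⊕ a ∙ vertical
        Y≈S⊕av = ≈-by₂ (proj₁ Y≈R⊕ad) (≈-sym s₁≈) (solve (y₁ ∷ s₁ ∷ r₁ ∷ a ∷ [])) ,
                 ≈-by₂ (proj₂ Y≈R⊕ad) (≈-sym s₂≈) (solve (y₂ ∷ s₂ ∷ r₂ ∷ a ∷ []))
        Z≈R : Z ≈² S ⊕ (- a) ∙ horizontal → Z ≈² R
        Z≈R (z₁≈ , z₂≈) = ≈-by₂ z₁≈ s₁≈ (solve (z₁ ∷ s₁ ∷ r₁ ∷ a ∷ [])) ,
                          ≈-by₂ z₂≈ s₂≈ (solve (z₂ ∷ s₂ ∷ r₂ ∷ []))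
        Z≈Y⊕ah : Z ≈² S ⊕ a ∙ diagonal → Z ≈² Y ⊕ a ∙ horizontal
        Z≈Y⊕ah (z₁≈ , z₂≈) = ≈-by₂ z₁≈ (≈-sym (proj₁ Y≈S⊕av)) (solve (z₁ ∷ y₁ ∷ s₁ ∷ a ∷ [])) ,
                             ≈-by₂ z₂≈ (≈-sym (proj₂ Y≈S⊕av)) (solve (z₂ ∷ y₂ ∷ s₂ ∷ a ∷ []))

    continues-above : ∀ {X Y Z R S a} → a ≉ 0ℤ →
      Y ≈² X ⊕ a ∙ horizontal → R ≈² X ⊕ a ∙ diagonal →
      Isolated R S Y → ¬ S ≈² X → Isolated S Y Z → ¬ Z ≈² R → Z ≈² Y ⊕ a ∙ horizontal
    continues-above {X@(x₁ , x₂)} {Y@(y₁ , y₂)} {Z@(z₁ , z₂)} {R@(r₁ , r₂)} {S@(s₁ , s₂)} {a}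
                    a≉0 (y₁≈ , y₂≈) (r₁≈ , r₂≈) RSY@(R~S , S~Y , _) S≉X SYZ@(_ , Y~Z , S~Z , _) Z≉R =
      [ (λ (_ , S≈) → ⊥-elim (collinear-not-isolated 4≤n vertical S≈ Y≈R⊕-av RSY))
      , [ S-right , (λ S≈R⊕-ad → ⊥-elim (S≉X (S≈X S≈R⊕-ad))) ]′ ]′
      (common-neighbour-vertical -a≉0 Y≈R⊕-av R~S (~-sym S~Y))
      where
      -a≉0 = neg-≉0 a≉0
      Y≈R⊕-av : Y ≈² R ⊕ (- a) ∙ vertical
      Y≈R⊕-av = ≈-by₂ y₁≈ (≈-sym r₁≈) (solve (y₁ ∷ r₁ ∷ x₁ ∷ a ∷ [])) ,
                ≈-by₂ y₂≈ (≈-sym r₂≈) (solve (y₂ ∷ r₂ ∷ x₂ ∷ a ∷ []))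

      S≈X : S ≈² R ⊕ (- a) ∙ diagonal → S ≈² X
      S≈X (s₁≈ , s₂≈) = ≈-by₂ s₁≈ r₁≈ (solve (s₁ ∷ r₁ ∷ x₁ ∷ a ∷ [])) ,
                        ≈-by₂ s₂≈ r₂≈ (solve (s₂ ∷ r₂ ∷ x₂ ∷ a ∷ []))

      S-right : S ≈² R ⊕ (- (- a)) ∙ horizontal → Z ≈² Y ⊕ a ∙ horizontal
      S-right (s₁≈ , s₂≈) =
        [ (λ (_ , Z≈) → ⊥-elim (collinear-not-isolated 4≤n diagonal Y≈S⊕-ad Z≈ SYZ))
        , [ (λ Z≈S⊕-ah → ⊥-elim (Z≉R (Z≈R Z≈S⊕-ah))) , Z≈Y⊕ah ]′ ]′
        (common-neighbour-diagonal -a≉0 Y≈S⊕-ad S~Z Y~Z)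
        where
        Y≈S⊕-ad : Y ≈² S ⊕ (- a) ∙ diagonal
        Y≈S⊕-ad = ≈-by₂ (proj₁ Y≈R⊕-av) (≈-sym s₁≈) (solve (y₁ ∷ s₁ ∷ r₁ ∷ a ∷ [])) ,
                  ≈-by₂ (proj₂ Y≈R⊕-av) (≈-sym s₂≈) (solve (y₂ ∷ s₂ ∷ r₂ ∷ a ∷ []))
        Z≈R : Z ≈² S ⊕ (- a) ∙ horizontal → Z ≈² R
        Z≈R (z₁≈ , z₂≈) = ≈-by₂ z₁≈ s₁≈ (solve (z₁ ∷ s₁ ∷ r₁ ∷ a ∷ [])) ,
                          ≈-by₂ z₂≈ s₂≈ (solve (z₂ ∷ s₂ ∷ r₂ ∷ []))
        Z≈Y⊕ah : Z ≈² S ⊕ (- a) ∙ vertical → Z ≈² Y ⊕ a ∙ horizontal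
        Z≈Y⊕ah (z₁≈ , z₂≈) = ≈-by₂ z₁≈ (≈-sym (proj₁ Y≈S⊕-ad)) (solve (z₁ ∷ y₁ ∷ s₁ ∷ a ∷ [])) ,
                             ≈-by₂ z₂≈ (≈-sym (proj₂ Y≈S⊕-ad)) (solve (z₂ ∷ y₂ ∷ s₂ ∷ a ∷ []))

    continues-horizontal : ∀ {X Y Z a} → Continues X Y Z →
      Y ≈² X ⊕ a ∙ horizontal → Z ≈² Y ⊕ a ∙ horizontal
    continues-horizontal {X} {Y} {a = a} (R , S , XYR@(X~Y , Y~R , X~R , _) , RSY , S≉X , SYZ , Z≉R) Y≈ =
      [ (λ (_ , R≈) → ⊥-elim (collinear-not-isolated 4≤n horizontal Y≈ R≈ XYR))
      , [ (λ R≈ → continues-below a≉0 Y≈ R≈ RSY S≉X SYZ Z≉R)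
        , (λ R≈ → continues-above a≉0 Y≈ R≈ RSY S≉X SYZ Z≉R) ]′ ]′
      (common-neighbour-horizontal a≉0 Y≈ X~R Y~R)
      where
      a≉0 = horizontal-step≉0 {X} {Y} X~Y Y≈

  row : ℕ → ℤ²
  row k = + k , 0ℤ

  row-step : ∀ k → row (suc k) ≈² row k ⊕ 1ℤ ∙ horizontal
  row-step k = ≈-reflexive (trans (ℤ.pos-+ 1 k) (ℤ.+-comm 1ℤ (+ k))) , ≈-refl

  horizontal-steps-add : ∀ {O P Q c a} → Q ≈² P ⊕ a ∙ horizontal → P ≈² O ⊕ c ∙ horizontal →
    Q ≈² O ⊕ (c + a) ∙ horizontal
  horizontal-steps-add {o₁ , o₂} {p₁ , p₂} {q₁ , q₂} {c} {a} (q₁≈ , q₂≈) (p₁≈ , p₂≈) =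
    ≈-by₂ q₁≈ p₁≈ (solve (q₁ ∷ p₁ ∷ o₁ ∷ c ∷ a ∷ [])) , ≈-by₂ q₂≈ p₂≈ (solve (q₂ ∷ p₂ ∷ o₂ ∷ []))

  horizontal-step≈0 : ∀ {O P c} → P ≈² O ⊕ c ∙ horizontal → c ≈ 0ℤ → P ≈² O
  horizontal-step≈0 {o₁ , o₂} {p₁ , p₂} {c} (p₁≈ , p₂≈) c≈0 =
    ≈-by₂ p₁≈ c≈0 (solve (p₁ ∷ o₁ ∷ c ∷ [])) , ≈-by₁ p₂≈ (solve (p₂ ∷ o₂ ∷ []))

  ≈²-⊕-0 : ∀ {P} → P ≈² P ⊕ 0ℤ ∙ horizontal
  ≈²-⊕-0 {p₁ , p₂} = ≈-reflexive (sym (ℤ.+-identityʳ p₁)) , ≈-reflexive (sym (ℤ.+-identityʳ p₂))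

  module RowImage (4≤n : 4 ℕ.≤ n) (F : Isomorphism cover cover) where
    open Isomorphism F

    image-step : ∀ {a} → to (row 1) ≈² to (row 0) ⊕ a ∙ horizontal →
      ∀ k → to (row (suc k)) ≈² to (row k) ⊕ a ∙ horizontal
    image-step step zero    = step
    image-step step (suc k) = continues-horizontal 4≤n row-continues (image-step step k)
      where
      2<n = ℕ.<⇒≤ 4≤n
      1<n = ℕ.<⇒≤ 2<n
      row-continues = preserves-continues
        (continues-source (+-≉0 ℕ.z<s 1<n) (+-≉0 ℕ.z<s 2<n) (row-step k) (row-step (suc k)))

    image-progression : ∀ {a} → to (row 1) ≈² to (row 0) ⊕ a ∙ horizontal →
      ∀ k → to (row k) ≈² to (row 0) ⊕ (+ k * a) ∙ horizontal
    image-progression step zero    = ≈²-⊕-0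
    image-progression {a} step (suc k) =
      subst (λ c → to (row (suc k)) ≈² to (row 0) ⊕ c ∙ horizontal) (ka+a≡[1+k]a (+ k) a)
            (horizontal-steps-add (image-step step k) (image-progression step k))
      where
      ka+a≡[1+k]a : ∀ x a → x * a + a ≡ (1ℤ + x) * a
      ka+a≡[1+k]a = solve-∀

    image-step-order : ∀ {a} → to (row 1) ≈² to (row 0) ⊕ a ∙ horizontal → ∀ k → + k * a ≈ 0ℤ → + k ≈ 0ℤ
    image-step-order step k ka≈0 = proj₁ (injective (horizontal-step≈0 (image-progression step k) ka≈0))

  on-row-step : ∀ {P Q x y} → P ≈² (x , 0ℤ) → Q ≈² (y , 0ℤ) → Q ≈² P ⊕ (y - x) ∙ horizontal
  on-row-step {p₁ , p₂} {q₁ , q₂} {x} {y} (p₁≈ , p₂≈) (q₁≈ , q₂≈) =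
    ≈-by₂ q₁≈ (≈-sym p₁≈) (solve (q₁ ∷ p₁ ∷ x ∷ y ∷ [])) , ≈-by₂ q₂≈ (≈-sym p₂≈) (solve (q₂ ∷ p₂ ∷ []))

  row-adjacent : ∀ {k} → 0 ℕ.< k → k ℕ.< n → row 0 ~ row k
  row-adjacent {k} 0<k k<n =
    ~-by-offset (InSℤ-∙ horizontal (+-≉0 0<k k<n)) (≈-reflexive (sym (ℤ.+-identityˡ (+ k))) , ≈-refl)

  n≈0 : + n ≈ 0ℤ
  n≈0 = ≈-intro (divides 1ℤ (n-0≡1*n (+ n)))
    where
    n-0≡1*n : ∀ n → n - 0ℤ ≡ 1ℤ * n
    n-0≡1*n = solve-∀

  unit-step-not-mapped-to-divisor-step : 4 ℕ.≤ n → ∀ {q d} → 0 ℕ.< q → q ℕ.< n → n ≡ q ℕ.* d →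
    (F : Isomorphism cover cover) → let open Isomorphism F in
    (to (row 0) ≈² row 0 × to (row 1) ≈² row d) ⊎ (to (row 0) ≈² row d × to (row 1) ≈² row 0) → ⊥
  unit-step-not-mapped-to-divisor-step 4≤n {q} {d} 0<q q<n n≡qd F =
    [ (λ (F0≈ , F1≈) → +-≉0 0<q q<n
        (image-step-order (on-row-step F0≈ F1≈) q (≈-trans (≈-reflexive qd≡n) n≈0)))
    , (λ (F0≈ , F1≈) → +-≉0 0<q q<n
        (image-step-order (on-row-step F0≈ F1≈) q (≈-trans (≈-reflexive -qd≡-n) (neg-cong n≈0)))) ]′
    where
    open RowImage 4≤n F
    qd≡n : + q * (+ d - 0ℤ) ≡ + n
    qd≡n = trans (cong (+ q *_) (ℤ.+-identityʳ (+ d))) (trans (sym (ℤ.pos-* q d)) (cong +_ (sym n≡qd)))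
    -qd≡-n : + q * (0ℤ - + d) ≡ - + n
    -qd≡-n = begin
      + q * (0ℤ - + d)  ≡⟨ cong (+ q *_) (ℤ.+-identityˡ (- + d)) ⟩
      + q * - + d       ≡⟨ ℤ.neg-distribʳ-* (+ q) (+ d) ⟨
      - (+ q * + d)     ≡⟨ cong -_ (trans (sym (ℤ.pos-* q d)) (cong +_ (sym n≡qd))) ⟩
      - + n             ∎
      where open ≡-Reasoning

  module Quotient .{{_ : NonZero n}} where
    ι : Fin n → ℤ
    ι a = + toℕ a

    π : ℤ → Fin n
    π x = fromℕ< (n%ℕd<d x n)

    ι-π : ∀ x → ι (π x) ≈ x
    ι-π x = ≈-intro (divides (- (x /ℕ n)) (begin
      ι (π x) - x                               ≡⟨ cong (λ r → + r - x) (Fin.toℕ-fromℕ< (n%ℕd<d x n)) ⟩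
      + (x %ℕ n) - x                            ≡⟨ cong (λ y → + (x %ℕ n) - y) (a≡a%ℕn+[a/ℕn]*n x n) ⟩
      + (x %ℕ n) - (+ (x %ℕ n) + x /ℕ n * + n)  ≡⟨ r-[r+qm]≡-qm (+ (x %ℕ n)) (x /ℕ n) (+ n) ⟩
      - (x /ℕ n) * + n                          ∎))
      where
      open ≡-Reasoning
      r-[r+qm]≡-qm : ∀ r q m → r - (r + q * m) ≡ - q * m
      r-[r+qm]≡-qm = solve-∀

    ι-injective : ∀ {a b} → ι a ≈ ι b → a ≡ b
    ι-injective {a} {b} e = Fin.toℕ-injective (+-≈-injective (Fin.toℕ<n a) (Fin.toℕ<n b) e)

    ι-subℤ : ∀ a b → ι (subℤ n a b) ≈ ι a - ι b
    ι-subℤ a b = ≈-trans (ι-π (+ (toℕ a ℕ.+ (n ∸ toℕ b)))) (≈-intro (divides 1ℤ (begin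
      + (toℕ a ℕ.+ (n ∸ toℕ b)) - (ι a - ι b)    ≡⟨ cong (_- (ι a - ι b)) (ℤ.pos-+ (toℕ a) (n ∸ toℕ b)) ⟩
      ι a + + (n ∸ toℕ b) - (ι a - ι b)          ≡⟨ cong (λ m → ι a + m - (ι a - ι b)) n∸b≡n-b ⟩
      ι a + (+ n - ι b) - (ι a - ι b)            ≡⟨ A+[N-B]-[A-B]≡1*N (ι a) (ι b) (+ n) ⟩
      1ℤ * + n                                   ∎)))
      where
      open ≡-Reasoning
      n∸b≡n-b : + (n ∸ toℕ b) ≡ + n - ι b
      n∸b≡n-b = trans (sym (ℤ.⊖-≥ (ℕ.<⇒≤ (Fin.toℕ<n b)))) (sym (ℤ.m-n≡m⊖n n (toℕ b)))
      A+[N-B]-[A-B]≡1*N : ∀ A B N → A + (N - B) - (A - B) ≡ 1ℤ * N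
      A+[N-B]-[A-B]≡1*N = solve-∀

    toℕ≡0⇔ι≈0 : ∀ a → toℕ a ≡ 0 ⇔ ι a ≈ 0ℤ
    toℕ≡0⇔ι≈0 a = mk⇔ (λ e → ≈-reflexive (cong +_ e))
                       (+-≈-injective (Fin.toℕ<n a) (ℕ.>-nonZero⁻¹ n))

    ≡⇔ι≈ι : ∀ a b → a ≡ b ⇔ ι a ≈ ι b
    ≡⇔ι≈ι a b = mk⇔ (λ e → ≈-reflexive (cong ι e)) ι-injective

    Γ : Graph
    Γ = record
      { Vertex          = G n
      ; _≈_             = _≡_
      ; ≈-isEquivalence = isEquivalence
      ; _~_             = Adj n
      ; ~-respˡ         = λ { refl g~h → g~h }
      ; ~-respʳ         = λ { refl g~h → g~h }
      }

    InS⇔InSℤ : ∀ {a b} → Defs.InS n (a , b) ⇔ InSℤ (ι a , ι b)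
    InS⇔InSℤ {a} {b} = mk⇔ to from
      where
      module A = Equivalence (toℕ≡0⇔ι≈0 a)
      module B = Equivalence (toℕ≡0⇔ι≈0 b)
      module AB = Equivalence (≡⇔ι≈ι a b)
      to : Defs.InS n (a , b) → InSℤ (ι a , ι b)
      to (inj₁ (a≢0 , b≡0))         = inj₁ (a≢0 ∘ A.from , B.to b≡0)
      to (inj₂ (inj₁ (a≡0 , b≢0)))  = inj₂ (inj₁ (A.to a≡0 , b≢0 ∘ B.from))
      to (inj₂ (inj₂ (a≢0 , a≡b)))  = inj₂ (inj₂ (a≢0 ∘ A.from , AB.to a≡b))
      from : InSℤ (ι a , ι b) → Defs.InS n (a , b)
      from (inj₁ (a≉0 , b≈0))        = inj₁ (a≉0 ∘ A.to , B.from b≈0)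
      from (inj₂ (inj₁ (a≈0 , b≉0))) = inj₂ (inj₁ (A.from a≈0 , b≉0 ∘ B.to))
      from (inj₂ (inj₂ (a≉0 , a≈b))) = inj₂ (inj₂ (a≉0 ∘ A.to , AB.from a≈b))

    ι² : G n → ℤ²
    ι² (a , b) = ι a , ι b

    ι²-subG : ∀ g h → ι² (subG n h g) ≈² ι² h ⊖ ι² g
    ι²-subG (g₁ , g₂) (h₁ , h₂) = ι-subℤ h₁ g₁ , ι-subℤ h₂ g₂

    lift : Isomorphism Γ cover
    lift = record
      { to         = ι²
      ; to-cong    = λ { refl → ≈²-refl }
      ; injective  = λ { {_ , _} {_ , _} (e₁ , e₂) → cong₂ _,_ (ι-injective e₁) (ι-injective e₂) }
      ; surjective = λ { (x₁ , x₂) → (π x₁ , π x₂) , ι-π x₁ , ι-π x₂ }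
      ; preserves  = λ {g} {h} g~h → adjacent (InSℤ-resp (ι²-subG g h) (Equivalence.to InS⇔InSℤ g~h))
      ; reflects   = λ {g} {h} (adjacent ιh-ιg∈S) →
                       Equivalence.from InS⇔InSℤ (InSℤ-resp (≈²-sym (ι²-subG g h)) ιh-ιg∈S)
      }

automorphism : ∀ {n} .{{_ : NonZero n}} → Automorphism n →
  Isomorphism (Modulo.Quotient.Γ n) (Modulo.Quotient.Γ n)
automorphism φ = record
  { to         = to
  ; to-cong    = cong to
  ; injective  = Injection.injective (↔⇒↣ bij)
  ; surjective = λ w → Inverse.from bij w , Inverse.strictlyInverseˡ bij w
  ; preserves  = preserves _ _
  ; reflects   = reflects _ _
  }
  where open Automorphism φ

theorem3p1 : (n : ℕ) .{{_ : NonZero n}} → n ≥ 4 → Composite n →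
    ¬ EdgeTransitive n
theorem3p1 n n≥4 (composite {d} d<n d∣n) edge-transitive =
  unit-step-not-mapped-to-divisor-step n≥4 0<q (quotient-< d∣n) (ℕ._∣_.equality d∣n)
    (lift ∘ᴵ (automorphism φ ∘ᴵ inverse lift))
    (Sum.map (Product.map (image (row 0) (row 0)) (image (row 1) (row d)))
             (Product.map (image (row 0) (row d)) (image (row 1) (row 0))) ends)
  where
  open Modulo n
  open Quotient
  open Isomorphism lift using (from; to-from)
  0<q = ℕ.>-nonZero⁻¹ _ {{quotient≢0 d∣n}}
  1<n = ℕ.<-≤-trans (ℕ.s≤s (ℕ.s≤s ℕ.z≤n)) n≥4
  0<d = ℕ.<-trans (ℕ.s≤s ℕ.z≤n) (ℕ.nonTrivial⇒n>1 d)
  edge = edge-transitive (from (row 0)) (from (row 1)) (from (row 0)) (from (row d))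
           (Isomorphism.preserves (inverse lift) (row-adjacent (ℕ.s≤s ℕ.z≤n) 1<n))
           (Isomorphism.preserves (inverse lift) (row-adjacent 0<d d<n))
  φ = proj₁ edge
  ends = proj₂ edge
  image : ∀ P Q → Automorphism.to φ (from P) ≡ from Q → ι² (Automorphism.to φ (from P)) ≈² Q
  image P Q e = ≈²-trans (Isomorphism.to-cong lift e) (to-from Q)
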